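{- Let $A$ be a c.e. set, $\mathcal{G}$ a collection of c.e. sets, and $D_0,D_1,\dots$ c.e. sets such that $\{D_0,D_1,\dots\}\cup\mathcal{G}$ generates $\mathcal{D}(A)$. Then there is a collection $\{\tilde D_0,\tilde D_1,\dots\}$ of c.e. sets with $\overline{A}=\bigcup_{i\in\omega}\tilde D_i$ such that $\{\tilde D_0,\tilde D_1,\dots\}\cup\mathcal{G}$ generates $\mathcal{D}(A)$; moreover, if the $D_i$ are pairwise disjoint, then the $\tilde D_i$ can be chosen pairwise disjoint (so that $\overline{A}=\bigsqcup_{i}\tilde D_i$).
   Context: All sets are c.e. subsets of $\omega$; $\overline{A}=\omega-A$. $X\subseteq^*Y$ means $X-Y$ is finite. A collection $\mathcal{H}$ of c.e. sets generates $\mathcal{D}(A)$ if every member of $\mathcal{H}$ is disjoint from $A$ and every c.e. set disjoint from $A$ is $\subseteq^*$ the union of finitely many members of $\mathcal{H}$. -}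

module Defs where

open import Data.Nat using (ℕ; zero; suc; _≤_; _<_)
open import Data.Fin using (Fin)
open import Data.Vec using (Vec; []; _∷_; lookup)
open import Data.List using (List)
open import Data.List.Relation.Unary.All using (All)
open import Data.List.Relation.Unary.Any using (Any)
open import Data.Product using (Σ; ∃; _×_)
open import Data.Sum using (_⊎_)
open import Data.Empty using (⊥)
open import Relation.Binary.PropositionalEquality using (_≡_)

-- Model of computation: codes of μ-recursive (partial recursive) functions of arity n.
data Code : ℕ → Set where
  zer  : ∀ {n} → Code n
  succ : Code 1
  proj : ∀ {n} → Fin n → Code n
  comp : ∀ {n m} → Code m → Vec (Code n) m → Code n
  prec : ∀ {n} → Code n → Code (suc (suc n)) → Code (suc n)
  mu   : ∀ {n} → Code (suc n) → Code n

mutual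
  data Eval : ∀ {n} → Code n → Vec ℕ n → ℕ → Set where
    ev-zer  : ∀ {n} {v : Vec ℕ n} → Eval zer v 0
    ev-succ : ∀ {x} → Eval succ (x ∷ []) (suc x)
    ev-proj : ∀ {n} {i : Fin n} {v} → Eval (proj i) v (lookup v i)
    ev-comp : ∀ {n m} {f : Code m} {gs : Vec (Code n) m} {v ys y} →
              EvalVec gs v ys → Eval f ys y → Eval (comp f gs) v y
    ev-prec0 : ∀ {n} {f : Code n} {g} {v y} →
               Eval f v y → Eval (prec f g) (0 ∷ v) y
    ev-precS : ∀ {n} {f : Code n} {g} {x v r y} →
               Eval (prec f g) (x ∷ v) r → Eval g (x ∷ r ∷ v) y →
               Eval (prec f g) (suc x ∷ v) y
    ev-mu   : ∀ {n} {f : Code (suc n)} {v y} →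
              Eval f (y ∷ v) 0 →
              (∀ z → z < y → ∃ λ k → Eval f (z ∷ v) (suc k)) →
              Eval (mu f) v y

  data EvalVec : ∀ {n m} → Vec (Code n) m → Vec ℕ n → Vec ℕ m → Set where
    []  : ∀ {n} {v : Vec ℕ n} → EvalVec [] v []
    _∷_ : ∀ {n m} {g : Code n} {gs : Vec (Code n) m} {v y ys} →
          Eval g v y → EvalVec gs v ys → EvalVec (g ∷ gs) v (y ∷ ys)

-- The c.e. set W_e with code e : domain of the unary partial recursive function e.
W : Code 1 → ℕ → Set
W e x = ∃ λ y → Eval e (x ∷ []) y

Disjoint : (ℕ → Set) → (ℕ → Set) → Set
Disjoint X Y = ∀ x → X x → Y x → ⊥

-- X ⊆* Y : X - Y is finite (all elements of X beyond some bound lie in Y).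
_⊆*_ : (ℕ → Set) → (ℕ → Set) → Set
X ⊆* Y = ∃ λ n → ∀ x → n ≤ x → X x → Y x

⋃L : List (Code 1) → ℕ → Set
⋃L L x = Any (λ e → W e x) L

Collection : Set₁
Collection = Code 1 → Set

Generates : Collection → Code 1 → Set
Generates H A =
  (∀ e → H e → Disjoint (W e) (W A)) ×
  (∀ c → Disjoint (W c) (W A) → Σ (List (Code 1)) λ L → All H L × (W c ⊆* ⋃L L))

SeqUnion : (ℕ → Code 1) → Collection → Collection
SeqUnion D G e = (∃ λ i → D i ≡ e) ⊎ G e

PairwiseDisjoint : (ℕ → Code 1) → Set
PairwiseDisjoint D = ∀ i j → (i ≡ j → ⊥) → Disjoint (W (D i)) (W (D j))

module Submission where

-- Given generators {D_j} ∪ G for D(A), adjoin to the D_j the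
-- "patch" sets P_k, where P_k = {k} if k lies neither in A nor in any D_j,
-- and P_k = ∅ otherwise (the case split uses excluded middle).  Interleaving
-- the two sequences gives D~ with D~(2j) = D_j and D~(2k+1) = P_k.
--   * Every point outside A lies in some D_j or in its own patch, and every
--     D~_i is disjoint from A, so the D~_i exactly cover the complement of A.
--   * The new collection contains the old one and still consists of sets
--     disjoint from A, so it still generates D(A).
--   * The patches are pairwise disjoint and disjoint from every D_j, so
--     interleaving preserves pairwise disjointness of the D_j.

open import Defs
open import Level using (0ℓ)
open import Axiom.ExcludedMiddle using (ExcludedMiddle)
open import Data.Nat using (ℕ; zero; suc)
open import Data.Fin using () renaming (zero to fzero; suc to fsuc)
open import Data.Vec using ([]; _∷_)
open import Data.Product using (Σ; ∃; _×_; _,_; proj₁; proj₂)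
open import Data.Sum using (_⊎_; inj₁; inj₂; [_,_])
open import Data.Empty using (⊥; ⊥-elim)
open import Data.List.Relation.Unary.All as All using ()
open import Relation.Nullary using (¬_; Dec; yes; no)
open import Function.Bundles using (_⇔_; mk⇔)
open import Relation.Binary.PropositionalEquality
  using (_≡_; refl; sym; trans; cong; subst)

constOne : ∀ {n} → Code n
constOne = comp succ (zer ∷ [])

constOne-eval : ∀ {n} {v} → Eval (constOne {n}) v 1
constOne-eval = ev-comp (ev-zer ∷ []) ev-succ

-- zeroAt n is a total unary function vanishing exactly at n
-- (it is 0 at n and 1 elsewhere, by recursion on n and the argument).
zeroAt : ℕ → Code 1
zeroAt zero    = prec zer constOne
zeroAt (suc n) = prec constOne (comp (zeroAt n) (proj fzero ∷ []))

zeroAt-total : ∀ n x → ∃ λ r → Eval (zeroAt n) (x ∷ []) r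
zeroAt-total zero    zero    = _ , ev-prec0 ev-zer
zeroAt-total zero    (suc x) = _ , ev-precS (proj₂ (zeroAt-total zero x)) constOne-eval
zeroAt-total (suc n) zero    = _ , ev-prec0 constOne-eval
zeroAt-total (suc n) (suc x) =
  _ , ev-precS (proj₂ (zeroAt-total (suc n) x)) (ev-comp (ev-proj ∷ []) (proj₂ (zeroAt-total n x)))

zeroAt-at : ∀ n → Eval (zeroAt n) (n ∷ []) 0
zeroAt-at zero    = ev-prec0 ev-zer
zeroAt-at (suc n) = ev-precS (proj₂ (zeroAt-total (suc n) n)) (ev-comp (ev-proj ∷ []) (zeroAt-at n))

zeroAt-only : ∀ n x → Eval (zeroAt n) (x ∷ []) 0 → x ≡ n
zeroAt-only zero    zero    _ = refl
zeroAt-only zero    (suc x) (ev-precS _ (ev-comp (ev-zer ∷ []) ()))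
zeroAt-only (suc n) zero    (ev-prec0 (ev-comp (ev-zer ∷ []) ()))
zeroAt-only (suc n) (suc x) (ev-precS _ (ev-comp (ev-proj ∷ []) q)) = cong suc (zeroAt-only n x q)

-- singleton n searches for the least y with zeroAt n x = 0 (ignoring y),
-- so it halts on x exactly when x = n: W (singleton n) = {n}.
singleton : ℕ → Code 1
singleton n = mu (comp (zeroAt n) (proj (fsuc fzero) ∷ []))

singleton-∋ : ∀ n → W (singleton n) n
singleton-∋ n = 0 , ev-mu (ev-comp (ev-proj ∷ []) (zeroAt-at n)) (λ _ ())

singleton-only : ∀ n x → W (singleton n) x → x ≡ n
singleton-only n x (_ , ev-mu (ev-comp (ev-proj ∷ []) q) _) = zeroAt-only n x q

-- Searching for a zero of the constant 1 never halts: W emptySet = ∅.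
emptySet : Code 1
emptySet = mu constOne

emptySet-empty : ∀ x → ¬ W emptySet x
emptySet-empty x (_ , ev-mu (ev-comp (ev-zer ∷ []) ()) _)

next : ℕ ⊎ ℕ → ℕ ⊎ ℕ
next (inj₁ a) = inj₂ a
next (inj₂ a) = inj₁ (suc a)

split : ℕ → ℕ ⊎ ℕ
split zero    = inj₁ zero
split (suc n) = next (split n)

-- The positions 2a and 2a+1 of the left and right copies of a.
mutual
  leftIndex : ℕ → ℕ
  leftIndex zero    = zero
  leftIndex (suc a) = suc (rightIndex a)

  rightIndex : ℕ → ℕ
  rightIndex a = suc (leftIndex a)

mutual
  split-left : ∀ a → split (leftIndex a) ≡ inj₁ a
  split-left zero    = refl
  split-left (suc a) = cong next (split-right a)

  split-right : ∀ a → split (rightIndex a) ≡ inj₂ a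
  split-right a = cong next (split-left a)

-- join inverts split; it is only needed to show that split is injective.
join : ℕ ⊎ ℕ → ℕ
join = [ leftIndex , rightIndex ]

join-next : ∀ s → join (next s) ≡ suc (join s)
join-next (inj₁ a) = refl
join-next (inj₂ a) = refl

join-split : ∀ n → join (split n) ≡ n
join-split zero    = refl
join-split (suc n) = trans (join-next (split n)) (cong suc (join-split n))

split-injective : ∀ {m n} → split m ≡ split n → m ≡ n
split-injective {m} {n} eq =
  trans (sym (join-split m)) (trans (cong join eq) (join-split n))

interleave : {X : Set} → (ℕ → X) → (ℕ → X) → ℕ → X
interleave f g i = [ f , g ] (split i)

interleave-left : {X : Set} (f g : ℕ → X) (a : ℕ) → interleave f g (leftIndex a) ≡ f a
interleave-left f g a = cong [ f , g ] (split-left a)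

interleave-right : {X : Set} (f g : ℕ → X) (a : ℕ) → interleave f g (rightIndex a) ≡ g a
interleave-right f g a = cong [ f , g ] (split-right a)

generates-enlarge : ∀ {H H′ : Collection} {A} →
  (∀ e → H e → H′ e) → (∀ e → H′ e → Disjoint (W e) (W A)) →
  Generates H A → Generates H′ A
generates-enlarge H⊆H′ disjoint (_ , covers) =
  disjoint , λ c c∩A=∅ → let (L , inH , c⊆*L) = covers c c∩A=∅
                          in L , All.map (λ {e} → H⊆H′ e) inH , c⊆*L

interleave-members : {X : Set} (f g : ℕ → X) (i : ℕ) →
  (∃ λ a → f a ≡ interleave f g i) ⊎ (∃ λ a → g a ≡ interleave f g i)
interleave-members f g i with split i
... | inj₁ a = inj₁ (a , refl)
... | inj₂ a = inj₂ (a , refl)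

seqUnion-interleave : (f g : ℕ → Code 1) (G : Collection) (e : Code 1) →
  SeqUnion f G e → SeqUnion (interleave f g) G e
seqUnion-interleave f g G e (inj₁ (a , refl)) = inj₁ (leftIndex a , interleave-left f g a)
seqUnion-interleave f g G e (inj₂ Ge)         = inj₂ Ge

interleave-pairwiseDisjoint : (f g : ℕ → Code 1) →
  PairwiseDisjoint f → PairwiseDisjoint g →
  (∀ a b → Disjoint (W (f a)) (W (g b))) →
  PairwiseDisjoint (interleave f g)
interleave-pairwiseDisjoint f g f-pd g-pd f∩g i j i≢j x
  with split i | split j | split-injective {i} {j}
... | inj₁ a | inj₁ b | inj
  = f-pd a b (λ a≡b → i≢j (inj (cong inj₁ a≡b))) x
... | inj₂ a | inj₂ b | inj
  = g-pd a b (λ a≡b → i≢j (inj (cong inj₂ a≡b))) x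
... | inj₁ a | inj₂ b | _ = f∩g a b x
... | inj₂ a | inj₁ b | _ = λ p q → f∩g b a x q p

module Patch (em : ExcludedMiddle 0ℓ) (A : Code 1) (D : ℕ → Code 1)
             (D-disjoint-A : ∀ j → Disjoint (W (D j)) (W A)) where

  Covered : ℕ → Set
  Covered k = W A k ⊎ (∃ λ j → W (D j) k)

  patchBy : ∀ k → Dec (Covered k) → Code 1
  patchBy k (yes _) = emptySet
  patchBy k (no _)  = singleton k

  patch : ℕ → Code 1
  patch k = patchBy k em

  patch-only : ∀ k x → W (patch k) x → (x ≡ k) × ¬ Covered k
  patch-only k x = go em
    where
    go : (d : Dec (Covered k)) → W (patchBy k d) x → (x ≡ k) × ¬ Covered k
    go (yes _)   w = ⊥-elim (emptySet-empty x w)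
    go (no ¬cov) w = singleton-only k x w , ¬cov

  patch-∋ : ∀ k → ¬ Covered k → W (patch k) k
  patch-∋ k ¬cov = go em
    where
    go : (d : Dec (Covered k)) → W (patchBy k d) k
    go (yes cov) = ⊥-elim (¬cov cov)
    go (no _)    = singleton-∋ k

  patch-disjoint-A : ∀ k → Disjoint (W (patch k)) (W A)
  patch-disjoint-A k x w a with patch-only k x w
  ... | refl , ¬cov = ¬cov (inj₁ a)

  patch-disjoint-D : ∀ j k → Disjoint (W (D j)) (W (patch k))
  patch-disjoint-D j k x d w with patch-only k x w
  ... | refl , ¬cov = ¬cov (inj₂ (j , d))

  -- Distinct patches are subsets of distinct singletons.
  patch-pairwiseDisjoint : PairwiseDisjoint patch
  patch-pairwiseDisjoint k l k≢l x p q =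
    k≢l (trans (sym (proj₁ (patch-only k x p))) (proj₁ (patch-only l x q)))

  uncovered-in-patch : ∀ x → ¬ W A x → (∃ λ j → W (D j) x) ⊎ W (patch x) x
  uncovered-in-patch x x∉A with em {∃ λ j → W (D j) x}
  ... | yes inD = inj₁ inD
  ... | no ¬inD = inj₂ (patch-∋ x λ { (inj₁ a) → x∉A a ; (inj₂ d) → ¬inD d })

  D~ : ℕ → Code 1
  D~ = interleave D patch

  -- Each D~_i is some D_j or some patch, both disjoint from A.
  D~-disjoint-A : ∀ i → Disjoint (W (D~ i)) (W A)
  D~-disjoint-A i with interleave-members D patch i
  ... | inj₁ (j , eq) = subst (λ e → Disjoint (W e) (W A)) eq (D-disjoint-A j)
  ... | inj₂ (k , eq) = subst (λ e → Disjoint (W e) (W A)) eq (patch-disjoint-A k)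

  D~-covers : ∀ x → (¬ W A x) ⇔ (∃ λ i → W (D~ i) x)
  D~-covers x = mk⇔ (λ x∉A → in-D~ (uncovered-in-patch x x∉A))
                    (λ (i , w) a → D~-disjoint-A i x w a)
    where
    in-D~ : (∃ λ j → W (D j) x) ⊎ W (patch x) x → ∃ λ i → W (D~ i) x
    in-D~ (inj₁ (j , w)) = leftIndex j , subst (λ e → W e x) (sym (interleave-left D patch j)) w
    in-D~ (inj₂ w)       = rightIndex x , subst (λ e → W e x) (sym (interleave-right D patch x)) w

  -- Patches are disjoint from each other and from the D_j.
  D~-pairwiseDisjoint : PairwiseDisjoint D → PairwiseDisjoint D~
  D~-pairwiseDisjoint D-pd =
    interleave-pairwiseDisjoint D patch D-pd patch-pairwiseDisjoint patch-disjoint-D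

lemma3p8 : ExcludedMiddle 0ℓ →
    (A : Code 1) (G : Collection) (D : ℕ → Code 1) →
    Generates (SeqUnion D G) A →
    Σ (ℕ → Code 1) λ D~ →
    (∀ x → (¬ W A x) ⇔ (∃ λ i → W (D~ i) x)) ×
    Generates (SeqUnion D~ G) A ×
    (PairwiseDisjoint D → PairwiseDisjoint D~)
lemma3p8 em A G D gen@(disjoint , _) = D~ , D~-covers , generates , D~-pairwiseDisjoint
  where
  open Patch em A D (λ j → disjoint (D j) (inj₁ (j , refl)))

  new-disjoint : ∀ e → SeqUnion D~ G e → Disjoint (W e) (W A)
  new-disjoint e (inj₁ (i , refl)) = D~-disjoint-A i
  new-disjoint e (inj₂ Ge)         = disjoint e (inj₂ Ge)

  generates : Generates (SeqUnion D~ G) A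
  generates = generates-enlarge (seqUnion-interleave D patch G) new-disjoint gen
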